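{- Let $m$ be an even positive integer, $q=2^{m/2}$, and let $r$ be a positive integer with $\gcd(r,m)=1$. Then for every $b\in\mathbb{F}_{q^2}^*$ the polynomial $\big(bX^{2^r}+1\big)^{q+1}+X^{q+1}$ has a zero in $\mathbb{F}_{q^2}$. -}

module Defs where

open import Level using (Level; _⊔_) renaming (suc to lsuc)
open import Data.Nat using (ℕ; zero; suc)
open import Data.Fin using (Fin)
open import Data.Product using (∃)
open import Relation.Nullary using (¬_)
open import Algebra.Bundles using (CommutativeRing)
open import Function.Bundles using (Bijection)
import Relation.Binary.PropositionalEquality as ≡

record FiniteField (c ℓ : Level) (n : ℕ) : Set (lsuc (c ⊔ ℓ)) where
  field
    commRing : CommutativeRing c ℓ
  open CommutativeRing commRing public
  field
    1≉0     : ¬ (1# ≈ 0#)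
    inverse : ∀ x → ¬ (x ≈ 0#) → ∃ λ y → x * y ≈ 1#
    card    : Bijection setoid (≡.setoid (Fin n))

  infixr 8 _^_
  _^_ : Carrier → ℕ → Carrier
  x ^ zero  = 1#
  x ^ suc k = x * (x ^ k)

{-# OPTIONS --safe #-}
-- Write q = 2 ^ k (so m = 2k), σ x = x ^ 2 ^ r, τ x = x ^ q and N x = x ^ (q + 1) = τ x · x.  In
-- characteristic 2 the claim is N (b σx + 1) = N x.  From gcd (r , 2k) = 1 we get r s = 1 + 2k t, which
-- makes σ ^ s the squaring map and σ ^ (s k) = τ.  Let μ ∈ F_q be the square root of N b.  The
-- telescoping product γ = μ · σμ ⋯ σ ^ (s - 1) μ is a nonzero element of F_q with σγ = γμ, and if
-- τz₀ + z₀ = γ (such z₀ exists because τ is not the identity) the telescoping sum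
-- Z = z₀ + σz₀ + ⋯ + σ ^ (s k - 1) z₀ satisfies σZ + γ = Z.  With α = σ⁻¹ (b γ)⁻¹ and x = α Z this gives
-- (b σx + 1) γ = σZ + γ = Z and N α · N γ = 1, hence N (b σx + 1) · N γ = N Z = N x · N γ.
module Submission where

open import Defs

open import Algebra.Bundles using (CommutativeMonoid; CommutativeSemiring; CommutativeRing)
import Algebra.Properties.CommutativeMonoid.Sum as Sum
import Algebra.Properties.CommutativeSemiring.Exp as Exp
import Algebra.Properties.Group as GroupProperties
import Algebra.Properties.Ring as RingProperties
import Algebra.Solver.CommutativeMonoid as CommutativeMonoidSolver
import Algebra.Solver.Ring.NaturalCoefficients.Default as SemiringSolver
open import Data.Empty using (⊥-elim)
open import Data.Fin using (Fin; zero; suc; punchIn; inject≤)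
open import Data.Fin.Permutation using (Permutation; permutation; remove; _⟨$⟩ʳ_; punchIn-permute)
open import Data.Fin.Properties
  using (¬Fin0; suc-injective; 0≢1+n; punchInᵢ≢i; ¬∀⟶∃¬; inject≤-injective) renaming (_≟_ to _≟ᶠ_)
open import Data.Nat using (ℕ; zero; suc; _≤_; _<_; s≤s; z≤n; _/_)
  renaming (_*_ to _*ℕ_; _+_ to _+ℕ_; _^_ to _^ℕ_)
open import Data.Nat.Coprimality using (coprime-Bézout; gcd≡1⇒coprime)
open import Data.Nat.DivMod using (m/n*n≡m)
open import Data.Nat.Divisibility using (_∣_; divides; ∣m⇒∣m*n; m∣m*n)
open import Data.Nat.GCD using (gcd; module Bézout)
open import Data.Nat.GeneralisedArithmetic using (iterate)
import Data.Nat.Properties as ℕ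
open import Data.Nat.Tactic.RingSolver using (solve-∀)
open import Data.Product using (∃; ∃₂; _,_; proj₁; proj₂)
open import Data.Vec using (Vec; []; _∷_; last; replicate; _∷ʳ_)
open import Data.Vec.Properties using (last-∷ʳ)
open import Function.Base using (_∘′_)
open import Function.Bundles using (Bijection; Surjection)
open import Function.Definitions using (Injective)
open import Relation.Binary.Definitions using (Decidable)
import Relation.Binary.PropositionalEquality as ≡
open import Relation.Binary.PropositionalEquality using (_≡_; cong)
import Relation.Binary.Reasoning.Setoid as SetoidReasoning
open import Relation.Nullary using (¬_; yes; no)
open import Relation.Unary using (Pred)

module OrbitProduct {c ℓ} (M : CommutativeMonoid c ℓ) where

  open CommutativeMonoid M
  open SetoidReasoning setoid
  open CommutativeMonoidSolver M using (solve; _⊕_; _⊜_)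

  orbitProduct : (Carrier → Carrier) → ℕ → Carrier → Carrier
  orbitProduct f zero    x = ε
  orbitProduct f (suc i) x = x ∙ orbitProduct f i (f x)

  orbitProduct-shift : ∀ {f} → (∀ x y → f (x ∙ y) ≈ f x ∙ f y) → f ε ≈ ε →
                       ∀ i x → f (orbitProduct f i x) ∙ x ≈ orbitProduct f i x ∙ iterate f x i
  orbitProduct-shift     f-∙ f-ε zero    x = trans (∙-congʳ f-ε) (trans (identityˡ x) (sym (identityˡ x)))
  orbitProduct-shift {f} f-∙ f-ε (suc i) x = begin
    f (x ∙ P) ∙ x                ≈⟨ ∙-congʳ (f-∙ x P) ⟩
    (f x ∙ f P) ∙ x              ≈⟨ solve 3 (λ a b c → (a ⊕ b) ⊕ c ⊜ c ⊕ (b ⊕ a)) refl (f x) (f P) x ⟩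
    x ∙ (f P ∙ f x)              ≈⟨ ∙-congˡ (orbitProduct-shift f-∙ f-ε i (f x)) ⟩
    x ∙ (P ∙ iterate f (f x) i)  ≈⟨ assoc x P _ ⟨
    (x ∙ P) ∙ iterate f (f x) i  ∎
    where P = orbitProduct f i (f x)

  orbitProduct-closed : ∀ {p f} (P : Pred Carrier p) → P ε → (∀ {x y} → P x → P y → P (x ∙ y)) →
                        (∀ {x} → P x → P (f x)) → ∀ i {x} → P x → P (orbitProduct f i x)
  orbitProduct-closed P Pε P∙ Pf zero    Px = Pε
  orbitProduct-closed P Pε P∙ Pf (suc i) Px = P∙ Px (orbitProduct-closed P Pε P∙ Pf i (Pf Px))

module Polynomial {c ℓ} (R : CommutativeRing c ℓ) where

  open CommutativeRing R hiding (zero)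
  open SetoidReasoning setoid
  open SemiringSolver commutativeSemiring using (solve; _:=_; _:+_; _:*_; con)
  open RingProperties ring using (-‿distribˡ-*)
  open GroupProperties +-group using (x∙y⁻¹≈ε⇒x≈y)
  open Exp commutativeSemiring using (_^_)

  -- Coefficient vectors start with the constant term, so last p is the top coefficient.
  eval : ∀ {d} → Vec Carrier d → Carrier → Carrier
  eval []       x = 0#
  eval (c ∷ cs) x = c + x * eval cs x

  monomial : ∀ d → Vec Carrier (suc d)
  monomial d = replicate d 0# ∷ʳ 1#

  eval-monomial : ∀ d x → eval (monomial d) x ≈ x ^ d
  eval-monomial zero    x = trans (+-congˡ (zeroʳ x)) (+-identityʳ 1#)
  eval-monomial (suc d) x = trans (+-identityˡ _) (*-congˡ (eval-monomial d x))

  quotient : ∀ {d} → Vec Carrier (suc d) → Carrier → Vec Carrier d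
  quotient (c ∷ [])         a = []
  quotient (c ∷ cs@(_ ∷ _)) a = eval cs a ∷ quotient cs a

  -- p(x) − p(a) = (x − a) q(x), with both sides moved so that no subtraction occurs.
  eval-quotient : ∀ {d} (p : Vec Carrier (suc d)) a x →
                  eval p x + a * eval (quotient p a) x ≈ eval p a + x * eval (quotient p a) x
  eval-quotient (c ∷ []) a x =
    solve 3 (λ c x a → (c :+ x :* con 0) :+ a :* con 0 := (c :+ a :* con 0) :+ x :* con 0) refl c x a
  eval-quotient (c ∷ cs@(_ ∷ _)) a x = begin
    (c + x * E) + a * (Eₐ + x * D) ≈⟨ solve 6 (λ c x a E Eₐ D → (c :+ x :* E) :+ a :* (Eₐ :+ x :* D)
                                              := (c :+ a :* Eₐ) :+ x :* (E :+ a :* D)) refl c x a E Eₐ D ⟩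
    (c + a * Eₐ) + x * (E + a * D)  ≈⟨ +-congˡ (*-congˡ (eval-quotient cs a x)) ⟩
    (c + a * Eₐ) + x * (Eₐ + x * D) ∎
    where
    E  = eval cs x
    Eₐ = eval cs a
    D  = eval (quotient cs a) x

  last-quotient : ∀ {d} (p : Vec Carrier (suc (suc d))) a → last (quotient p a) ≈ last p
  last-quotient (c ∷ c′ ∷ [])         a = trans (+-congˡ (zeroʳ a)) (+-identityʳ c′)
  last-quotient (c ∷ cs@(_ ∷ _ ∷ _)) a = last-quotient cs a

  module _ (zero-divisor-free : ∀ {z x} → ¬ z ≈ 0# → z * x ≈ 0# → x ≈ 0#) where

    root-quotient : ∀ {d} (p : Vec Carrier (suc d)) {a x} → ¬ x ≈ a →
                    eval p a ≈ 0# → eval p x ≈ 0# → eval (quotient p a) x ≈ 0#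
    root-quotient p {a} {x} x≉a pa≈0 px≈0 = zero-divisor-free (x≉a ∘′ x∙y⁻¹≈ε⇒x≈y x a) (begin
      (x - a) * D      ≈⟨ distribʳ D x (- a) ⟩
      x * D + - a * D  ≈⟨ +-congˡ (sym (-‿distribˡ-* a D)) ⟩
      x * D - a * D    ≈⟨ +-congˡ (-‿cong aD≈xD) ⟩
      x * D - x * D    ≈⟨ -‿inverseʳ (x * D) ⟩
      0#               ∎)
      where
      D = eval (quotient p a) x
      aD≈xD : a * D ≈ x * D
      aD≈xD = begin
        a * D             ≈⟨ +-identityˡ (a * D) ⟨
        0# + a * D        ≈⟨ +-congʳ px≈0 ⟨
        eval p x + a * D  ≈⟨ eval-quotient p a x ⟩
        eval p a + x * D  ≈⟨ +-congʳ pa≈0 ⟩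
        0# + x * D        ≈⟨ +-identityˡ (x * D) ⟩
        x * D             ∎

    distinct-roots⇒last≈0 : ∀ {d} (p : Vec Carrier (suc d)) (xs : Fin (suc d) → Carrier) →
                             Injective _≡_ _≈_ xs → (∀ i → eval p (xs i) ≈ 0#) → last p ≈ 0#
    distinct-roots⇒last≈0 (c ∷ []) xs _ roots =
      trans (sym (trans (+-congˡ (zeroʳ (xs zero))) (+-identityʳ c))) (roots zero)
    distinct-roots⇒last≈0 p@(_ ∷ _ ∷ _) xs xs-injective roots =
      trans (sym (last-quotient p (xs zero)))
        (distinct-roots⇒last≈0 (quotient p (xs zero)) (xs ∘′ suc) (suc-injective ∘′ xs-injective)
          (λ i → root-quotient p (λ eq → 0≢1+n (xs-injective (sym eq))) (roots zero) (roots (suc i))))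

module Powers {c ℓ} (S : CommutativeSemiring c ℓ) where

  open CommutativeSemiring S
  open Exp S public
  open SetoidReasoning setoid
  open SemiringSolver S using (solve; _:=_; _:+_; _:*_; con)

  ^-zeroˡ : ∀ e → 1# ^ e ≈ 1#
  ^-zeroˡ zero    = refl
  ^-zeroˡ (suc e) = trans (*-identityˡ _) (^-zeroˡ e)

  ^-^-comm : ∀ x a b → (x ^ a) ^ b ≈ (x ^ b) ^ a
  ^-^-comm x a b = begin
    (x ^ a) ^ b   ≈⟨ ^-assocʳ x a b ⟩
    x ^ (a *ℕ b)  ≡⟨ cong (x ^_) (ℕ.*-comm a b) ⟩
    x ^ (b *ℕ a)  ≈⟨ ^-assocʳ x b a ⟨
    (x ^ b) ^ a   ∎

  iterate-^ : ∀ e i x → iterate (_^ e) x i ≈ x ^ (e ^ℕ i)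
  iterate-^ e zero    x = sym (*-identityʳ x)
  iterate-^ e (suc i) x = trans (iterate-^ e i (x ^ e)) (^-assocʳ x e (e ^ℕ i))

  frob : ℕ → Carrier → Carrier
  frob j x = x ^ (2 ^ℕ j)

  frob-frob : ∀ i j x → frob i (frob j x) ≈ frob (j +ℕ i) x
  frob-frob i j x = begin
    (x ^ (2 ^ℕ j)) ^ (2 ^ℕ i)  ≈⟨ ^-assocʳ x (2 ^ℕ j) (2 ^ℕ i) ⟩
    x ^ (2 ^ℕ j *ℕ 2 ^ℕ i)     ≡⟨ cong (x ^_) (ℕ.^-distribˡ-+-* 2 j i) ⟨
    x ^ (2 ^ℕ (j +ℕ i))        ∎

  frob-0 : ∀ j → frob j 0# ≈ 0#
  frob-0 zero    = zeroˡ 1#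
  frob-0 (suc j) = trans (sym (frob-frob j 1 0#)) (trans (^-congˡ (2 ^ℕ j) (zeroˡ _)) (frob-0 j))

  module Characteristic2 (x+x≈0 : ∀ x → x + x ≈ 0#) where

    ^2-distrib-+ : ∀ x y → (x + y) ^ 2 ≈ x ^ 2 + y ^ 2
    ^2-distrib-+ x y = begin
      (x + y) ^ 2                        ≈⟨ solve 2 (λ x y → (x :+ y) :* ((x :+ y) :* con 1)
                                              := (x :* (x :* con 1) :+ y :* (y :* con 1)) :+ (x :* y :+ x :* y)) refl x y ⟩
      (x ^ 2 + y ^ 2) + (x * y + x * y)  ≈⟨ +-congˡ (x+x≈0 (x * y)) ⟩
      (x ^ 2 + y ^ 2) + 0#               ≈⟨ +-identityʳ _ ⟩
      x ^ 2 + y ^ 2                      ∎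

    x≈y⇒x+y≈0 : ∀ {x y} → x ≈ y → x + y ≈ 0#
    x≈y⇒x+y≈0 {x} x≈y = trans (+-congˡ (sym x≈y)) (x+x≈0 x)

    x+y≈0⇒x≈y : ∀ {x y} → x + y ≈ 0# → x ≈ y
    x+y≈0⇒x≈y {x} {y} x+y≈0 = begin
      x             ≈⟨ +-identityʳ x ⟨
      x + 0#        ≈⟨ +-congˡ (x+x≈0 y) ⟨
      x + (y + y)   ≈⟨ +-assoc x y y ⟨
      (x + y) + y   ≈⟨ +-congʳ x+y≈0 ⟩
      0# + y        ≈⟨ +-identityˡ y ⟩
      y             ∎

    frob-+ : ∀ j x y → frob j (x + y) ≈ frob j x + frob j y
    frob-+ zero    x y = trans (*-identityʳ _) (sym (+-cong (*-identityʳ x) (*-identityʳ y)))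
    frob-+ (suc j) x y = begin
      frob (suc j) (x + y)                ≈⟨ frob-frob j 1 (x + y) ⟨
      frob j ((x + y) ^ 2)                ≈⟨ ^-congˡ (2 ^ℕ j) (^2-distrib-+ x y) ⟩
      frob j (x ^ 2 + y ^ 2)              ≈⟨ frob-+ j (x ^ 2) (y ^ 2) ⟩
      frob j (x ^ 2) + frob j (y ^ 2)     ≈⟨ +-cong (frob-frob j 1 x) (frob-frob j 1 y) ⟩
      frob (suc j) x + frob (suc j) y     ∎

-- The size is written suc n so that Fermat's theorem for nonzero a reads a ^ n ≈ 1#.
module FiniteFieldProperties {c ℓ n} (F : FiniteField c ℓ (suc n)) where

  open FiniteField F hiding (_^_; zero)
  open Powers commutativeSemiring public
  open SetoidReasoning setoid
  open Bijection card using (to; injective) renaming (cong to to-cong)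
  open Surjection (Bijection.surjection card) using (to⁻; to∘to⁻)
  open Sum *-commutativeMonoid using (sum-cong-≋; sum-replicate; ∑-distrib-+; ∑-permute)
    renaming (sum to ∏)

  elem : Fin (suc n) → Carrier
  elem = to⁻

  elem-to : ∀ x → elem (to x) ≈ x
  elem-to x = injective (to∘to⁻ (to x))

  infix 4 _≟_
  _≟_ : Decidable _≈_
  x ≟ y with to x ≟ᶠ to y
  ... | yes eq = yes (injective eq)
  ... | no neq = no (neq ∘′ to-cong)

  inverseˡ : ∀ {x} (x≉0 : ¬ x ≈ 0#) → proj₁ (inverse x x≉0) * x ≈ 1#
  inverseˡ {x} x≉0 = trans (*-comm _ x) (proj₂ (inverse x x≉0))

  *-cancelʳ : ∀ {z x y} → ¬ z ≈ 0# → x * z ≈ y * z → x ≈ y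
  *-cancelʳ {z} {x} {y} z≉0 xz≈yz = begin
    x                ≈⟨ *-identityʳ x ⟨
    x * 1#           ≈⟨ *-congˡ (proj₂ (inverse z z≉0)) ⟨
    x * (z * z⁻¹)    ≈⟨ *-assoc x z z⁻¹ ⟨
    (x * z) * z⁻¹    ≈⟨ *-congʳ xz≈yz ⟩
    (y * z) * z⁻¹    ≈⟨ *-assoc y z z⁻¹ ⟩
    y * (z * z⁻¹)    ≈⟨ *-congˡ (proj₂ (inverse z z≉0)) ⟩
    y * 1#           ≈⟨ *-identityʳ y ⟩
    y                ∎
    where z⁻¹ = proj₁ (inverse z z≉0)

  zero-divisor-free : ∀ {z x} → ¬ z ≈ 0# → z * x ≈ 0# → x ≈ 0#
  zero-divisor-free {z} {x} z≉0 zx≈0 =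
    *-cancelʳ z≉0 (trans (*-comm x z) (trans zx≈0 (sym (zeroˡ z))))

  x*y≉0 : ∀ {x y} → ¬ x ≈ 0# → ¬ y ≈ 0# → ¬ x * y ≈ 0#
  x*y≉0 x≉0 y≉0 xy≈0 = y≉0 (zero-divisor-free x≉0 xy≈0)

  x^e≉0 : ∀ {x} → ¬ x ≈ 0# → ∀ e → ¬ x ^ e ≈ 0#
  x^e≉0 x≉0 zero    = 1≉0
  x^e≉0 x≉0 (suc e) = x*y≉0 x≉0 (x^e≉0 x≉0 e)

  ∏≉0 : ∀ {m} (f : Fin m → Carrier) → (∀ i → ¬ f i ≈ 0#) → ¬ ∏ f ≈ 0#
  ∏≉0 {zero}  f f≉0 = 1≉0
  ∏≉0 {suc m} f f≉0 = x*y≉0 (f≉0 zero) (∏≉0 (f ∘′ suc) (λ i → f≉0 (suc i)))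

  -- Multiplication by a nonzero a permutes the nonzero elements ν, so a ^ n ∏ ν ≈ ∏ ν.
  module _ {a} (a≉0 : ¬ a ≈ 0#) where

    private
      i₀ : Fin (suc n)
      i₀ = to 0#

      ν : Fin n → Carrier
      ν j = elem (punchIn i₀ j)

      ν≉0 : ∀ j → ¬ ν j ≈ 0#
      ν≉0 j ν≈0 = punchInᵢ≢i i₀ j (≡.trans (≡.sym (to∘to⁻ _)) (to-cong ν≈0))

      a⁻¹ = proj₁ (inverse a a≉0)

      scale : Permutation (suc n) (suc n)
      scale = permutation (λ i → to (a * elem i)) (λ i → to (a⁻¹ * elem i))
        (λ i → cancel (proj₂ (inverse a a≉0)) i) (λ i → cancel (inverseˡ a≉0) i)
        where
        cancel : ∀ {b b′} → b * b′ ≈ 1# → ∀ i → to (b * elem (to (b′ * elem i))) ≡ i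
        cancel {b} {b′} bb′≈1 i = ≡.trans (to-cong (begin
          b * elem (to (b′ * elem i))  ≈⟨ *-congˡ (elem-to _) ⟩
          b * (b′ * elem i)            ≈⟨ *-assoc b b′ _ ⟨
          (b * b′) * elem i            ≈⟨ *-congʳ bb′≈1 ⟩
          1# * elem i                  ≈⟨ *-identityˡ _ ⟩
          elem i                       ∎)) (to∘to⁻ i)

      scale-i₀ : scale ⟨$⟩ʳ i₀ ≡ i₀
      scale-i₀ = to-cong (trans (*-congˡ (elem-to 0#)) (zeroʳ a))

      scale′ : Permutation n n
      scale′ = remove i₀ scale

      ν-scale′ : ∀ j → ν (scale′ ⟨$⟩ʳ j) ≈ a * ν j
      ν-scale′ j = begin
        elem (punchIn i₀ (scale′ ⟨$⟩ʳ j))              ≡⟨ ≡.cong (λ i → elem (punchIn i (scale′ ⟨$⟩ʳ j))) scale-i₀ ⟨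
        elem (punchIn (scale ⟨$⟩ʳ i₀) (scale′ ⟨$⟩ʳ j))  ≡⟨ ≡.cong elem (punchIn-permute scale i₀ j) ⟨
        elem (to (a * ν j))                            ≈⟨ elem-to _ ⟩
        a * ν j                                        ∎

    fermat-≉0 : a ^ n ≈ 1#
    fermat-≉0 = sym (*-cancelʳ (∏≉0 ν ν≉0) (begin
      1# * ∏ ν                 ≈⟨ *-identityˡ _ ⟩
      ∏ ν                      ≈⟨ ∑-permute ν scale′ ⟩
      ∏ (ν ∘′ (scale′ ⟨$⟩ʳ_))  ≈⟨ sum-cong-≋ ν-scale′ ⟩
      ∏ (λ j → a * ν j)        ≈⟨ ∑-distrib-+ (λ _ → a) ν ⟩
      ∏ {n} (λ _ → a) * ∏ ν    ≈⟨ *-congʳ (sum-replicate n) ⟩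
      a ^ n * ∏ ν              ∎))

  fermat : ∀ x → x ^ suc n ≈ x
  fermat x with x ≟ 0#
  ... | yes x≈0 = trans (*-congʳ x≈0) (trans (zeroˡ _) (sym x≈0))
  ... | no  x≉0 = trans (*-congˡ (fermat-≉0 x≉0)) (*-identityʳ x)

  fermat-^ : ∀ t x → x ^ (suc n ^ℕ t) ≈ x
  fermat-^ zero    x = *-identityʳ x
  fermat-^ (suc t) x = begin
    x ^ (suc n *ℕ suc n ^ℕ t)  ≈⟨ ^-assocʳ x (suc n) (suc n ^ℕ t) ⟨
    (x ^ suc n) ^ (suc n ^ℕ t)  ≈⟨ ^-congˡ (suc n ^ℕ t) (fermat x) ⟩
    x ^ (suc n ^ℕ t)            ≈⟨ fermat-^ t x ⟩
    x                            ∎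

  open RingProperties ring using (-1*x≈-x; -‿distribʳ-*; -‿involutive)

  even-size⇒x+x≈0 : 2 ∣ suc n → ∀ x → x + x ≈ 0#
  even-size⇒x+x≈0 (divides h size≡h*2) x = begin
    x + x           ≈⟨ +-congˡ (*-identityˡ x) ⟨
    x + 1# * x      ≈⟨ +-congˡ (*-congʳ 1≈-1) ⟩
    x + - 1# * x    ≈⟨ +-congˡ (-1*x≈-x x) ⟩
    x - x           ≈⟨ -‿inverseʳ x ⟩
    0#              ∎
    where
    1≈-1 : 1# ≈ - 1#
    1≈-1 = begin
      1#                  ≈⟨ ^-zeroˡ h ⟨
      1# ^ h              ≈⟨ ^-congˡ h (trans (*-congˡ (*-identityʳ (- 1#))) (trans (-1*x≈-x (- 1#)) (-‿involutive 1#))) ⟨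
      ((- 1#) ^ 2) ^ h    ≈⟨ ^-^-comm (- 1#) 2 h ⟩
      ((- 1#) ^ h) ^ 2    ≈⟨ ^-assocʳ (- 1#) h 2 ⟩
      (- 1#) ^ (h *ℕ 2)  ≡⟨ cong ((- 1#) ^_) size≡h*2 ⟨
      (- 1#) ^ suc n      ≈⟨ fermat (- 1#) ⟩
      - 1#                ∎

  open Polynomial commRing

  ∃x^Q≉x : ∀ {Q} → 2 ≤ Q → Q < suc n → ∃ λ δ → ¬ δ ^ Q ≈ δ
  ∃x^Q≉x {Q@(suc (suc j))} (s≤s (s≤s _)) Q<size =
    let i , i-moved = ¬∀⟶∃¬ (suc n) (λ i → elem i ^ Q ≈ elem i) (λ i → elem i ^ Q ≟ elem i) ¬all-fixed
    in elem i , i-moved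
    where
    X^Q-X : Vec Carrier (suc Q)
    X^Q-X = 0# ∷ - 1# ∷ monomial j

    eval-X^Q-X : ∀ x → eval X^Q-X x ≈ x ^ Q - x
    eval-X^Q-X x = begin
      0# + x * (- 1# + x * eval (monomial j) x)  ≈⟨ +-identityˡ _ ⟩
      x * (- 1# + x * eval (monomial j) x)       ≈⟨ *-congˡ (+-congˡ (*-congˡ (eval-monomial j x))) ⟩
      x * (- 1# + x ^ suc j)                     ≈⟨ distribˡ x (- 1#) (x ^ suc j) ⟩
      x * - 1# + x ^ Q                           ≈⟨ +-congʳ (trans (sym (-‿distribʳ-* x 1#)) (-‿cong (*-identityʳ x))) ⟩
      - x + x ^ Q                                ≈⟨ +-comm (- x) (x ^ Q) ⟩
      x ^ Q - x                                  ∎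

    xs : Fin (suc Q) → Carrier
    xs i = elem (inject≤ i Q<size)

    xs-injective : Injective _≡_ _≈_ xs
    xs-injective {i} {i′} eq = inject≤-injective Q<size Q<size i i′
      (≡.trans (≡.sym (to∘to⁻ _)) (≡.trans (to-cong eq) (to∘to⁻ _)))

    ¬all-fixed : ¬ (∀ i → elem i ^ Q ≈ elem i)
    ¬all-fixed fixed = 1≉0 (begin
      1#          ≡⟨ last-∷ʳ 1# (replicate j 0#) ⟨
      last X^Q-X  ≈⟨ distinct-roots⇒last≈0 zero-divisor-free X^Q-X xs xs-injective root ⟩
      0#          ∎)
      where
      root : ∀ i → eval X^Q-X (xs i) ≈ 0#
      root i = trans (eval-X^Q-X (xs i)) (trans (+-congʳ (fixed _)) (-‿inverseʳ (xs i)))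

module NormEquation {c ℓ n} (F : FiniteField c ℓ (suc n)) (k′ : ℕ)
  (size≡q*q : suc n ≡ 2 ^ℕ suc k′ *ℕ 2 ^ℕ suc k′)
  (r s t : ℕ) (rs≡1+tM : r *ℕ s ≡ suc (t *ℕ (suc k′ +ℕ suc k′))) where

  open FiniteField F hiding (_^_; zero)
  open FiniteFieldProperties F
  open SetoidReasoning setoid
  open SemiringSolver commutativeSemiring using (solve; _:=_; _:*_; _:+_; con)

  k q M M′ : ℕ
  k  = suc k′
  q  = 2 ^ℕ k
  M  = k +ℕ k
  M′ = k′ +ℕ k

  σ τ N : Carrier → Carrier
  σ = frob r
  τ = frob k
  N x = x ^ (q +ℕ 1)

  frob-period : ∀ t x → frob (M *ℕ t) x ≈ x
  frob-period t x = begin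
    x ^ (2 ^ℕ (M *ℕ t))  ≡⟨ cong (x ^_) (ℕ.^-*-assoc 2 M t) ⟨
    x ^ ((2 ^ℕ M) ^ℕ t)  ≡⟨ cong (λ e → x ^ (e ^ℕ t)) (≡.trans (ℕ.^-distribˡ-+-* 2 k k) (≡.sym size≡q*q)) ⟩
    x ^ (suc n ^ℕ t)     ≈⟨ fermat-^ t x ⟩
    x                    ∎

  frob-M : ∀ x → frob M x ≈ x
  frob-M x = trans (reflexive (cong (λ e → frob e x) (≡.sym (ℕ.*-identityʳ M)))) (frob-period 1 x)

  x+x≈0 : ∀ x → x + x ≈ 0#
  x+x≈0 = even-size⇒x+x≈0 (≡.subst (2 ∣_) (≡.sym size≡q*q) (∣m⇒∣m*n q (m∣m*n (2 ^ℕ k′))))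

  open Characteristic2 x+x≈0

  N≈τ* : ∀ x → N x ≈ τ x * x
  N≈τ* x = trans (^-homo-* x q 1) (*-congˡ (*-identityʳ x))

  N-* : ∀ x y → N (x * y) ≈ N x * N y
  N-* x y = ^-distrib-* x y (q +ℕ 1)

  τ-* : ∀ x y → τ (x * y) ≈ τ x * τ y
  τ-* x y = ^-distrib-* x y q

  τ-involutive : ∀ x → τ (τ x) ≈ x
  τ-involutive x = trans (frob-frob k k x) (frob-M x)

  τ-N : ∀ x → τ (N x) ≈ N x
  τ-N x = begin
    τ (N x)          ≈⟨ ^-congˡ q (N≈τ* x) ⟩
    τ (τ x * x)      ≈⟨ τ-* (τ x) x ⟩
    τ (τ x) * τ x    ≈⟨ *-congʳ (τ-involutive x) ⟩
    x * τ x          ≈⟨ *-comm x (τ x) ⟩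
    τ x * x          ≈⟨ N≈τ* x ⟨
    N x              ∎

  τ-fixed-inverse : ∀ {y y′} → τ y ≈ y → y * y′ ≈ 1# → τ y′ ≈ y′
  τ-fixed-inverse {y} {y′} τy≈y yy′≈1 = *-cancelʳ y≉0 (begin
    τ y′ * y       ≈⟨ *-congˡ τy≈y ⟨
    τ y′ * τ y     ≈⟨ *-comm (τ y′) (τ y) ⟩
    τ y * τ y′     ≈⟨ τ-* y y′ ⟨
    τ (y * y′)     ≈⟨ ^-congˡ q yy′≈1 ⟩
    τ 1#           ≈⟨ ^-zeroˡ q ⟩
    1#             ≈⟨ yy′≈1 ⟨
    y * y′         ≈⟨ *-comm y y′ ⟩
    y′ * y         ∎)
    where
    y≉0 : ¬ y ≈ 0#
    y≉0 y≈0 = 1≉0 (trans (sym yy′≈1) (trans (*-congʳ y≈0) (zeroˡ y′)))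

  σ⁻¹ : Carrier → Carrier
  σ⁻¹ = frob (M′ *ℕ r)

  σ⁻¹-σ : ∀ x → σ⁻¹ (σ x) ≈ x
  σ⁻¹-σ x = trans (frob-frob (M′ *ℕ r) r x) (frob-period r x)

  σ-σ⁻¹ : ∀ x → σ (σ⁻¹ x) ≈ x
  σ-σ⁻¹ x = trans (^-^-comm x (2 ^ℕ (M′ *ℕ r)) (2 ^ℕ r)) (σ⁻¹-σ x)

  -- r s ≡ 1 (mod M) makes σ ^ s the squaring map.
  iterate-σ : ∀ j x → iterate σ x (s *ℕ j) ≈ frob j x
  iterate-σ j x = begin
    iterate σ x (s *ℕ j)             ≈⟨ iterate-^ (2 ^ℕ r) (s *ℕ j) x ⟩
    x ^ ((2 ^ℕ r) ^ℕ (s *ℕ j))       ≡⟨ cong (x ^_) (ℕ.^-*-assoc 2 r (s *ℕ j)) ⟩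
    x ^ (2 ^ℕ (r *ℕ (s *ℕ j)))       ≡⟨ cong (λ e → x ^ (2 ^ℕ e)) exponent ⟩
    frob (j +ℕ M *ℕ (t *ℕ j)) x      ≈⟨ frob-frob (M *ℕ (t *ℕ j)) j x ⟨
    frob (M *ℕ (t *ℕ j)) (frob j x)  ≈⟨ frob-period (t *ℕ j) (frob j x) ⟩
    frob j x                         ∎
    where
    exponent : r *ℕ (s *ℕ j) ≡ j +ℕ M *ℕ (t *ℕ j)
    exponent = ≡.trans (≡.sym (ℕ.*-assoc r s j)) (≡.trans (cong (_*ℕ j) rs≡1+tM) (rearrange t M j))
      where
      rearrange : ∀ t M j → suc (t *ℕ M) *ℕ j ≡ j +ℕ M *ℕ (t *ℕ j)
      rearrange = solve-∀

  open OrbitProduct *-commutativeMonoid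
    renaming (orbitProduct to ∏orbit; orbitProduct-shift to ∏orbit-shift; orbitProduct-closed to ∏orbit-closed)
  open OrbitProduct +-commutativeMonoid
    renaming (orbitProduct to ∑orbit; orbitProduct-shift to ∑orbit-shift)

  2≤q : 2 ≤ q
  2≤q = ℕ.m≤m*n 2 (2 ^ℕ k′) {{ℕ.m^n≢0 2 k′}}

  q<size : q < suc n
  q<size = ≡.subst (q <_) (≡.sym size≡q*q) (ℕ.m<m*n q q {{ℕ.m^n≢0 2 k}} 2≤q)

  module Solution {b} (b≉0 : ¬ b ≈ 0#) where

    μ : Carrier
    μ = frob M′ (N b)

    μ*μ≈Nb : μ * μ ≈ N b
    μ*μ≈Nb = begin
      μ * μ                   ≈⟨ *-congˡ (*-identityʳ μ) ⟨
      frob 1 μ                ≈⟨ ^-^-comm (N b) (2 ^ℕ M′) 2 ⟩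
      frob M′ (frob 1 (N b))  ≈⟨ frob-frob M′ 1 (N b) ⟩
      frob M (N b)            ≈⟨ frob-M (N b) ⟩
      N b                     ∎

    τμ≈μ : τ μ ≈ μ
    τμ≈μ = trans (^-^-comm (N b) (2 ^ℕ M′) q) (^-congˡ (2 ^ℕ M′) (τ-N b))

    Nμ≈Nb : N μ ≈ N b
    Nμ≈Nb = trans (N≈τ* μ) (trans (*-congʳ τμ≈μ) μ*μ≈Nb)

    μ≉0 : ¬ μ ≈ 0#
    μ≉0 = x^e≉0 (x^e≉0 b≉0 (q +ℕ 1)) (2 ^ℕ M′)

    γ : Carrier
    γ = ∏orbit σ s μ

    σγ≈γμ : σ γ ≈ γ * μ
    σγ≈γμ = *-cancelʳ μ≉0 (begin
      σ γ * μ                   ≈⟨ ∏orbit-shift (λ x y → ^-distrib-* x y (2 ^ℕ r)) (^-zeroˡ (2 ^ℕ r)) s μ ⟩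
      γ * iterate σ μ s         ≡⟨ cong (λ i → γ * iterate σ μ i) (ℕ.*-identityʳ s) ⟨
      γ * iterate σ μ (s *ℕ 1)  ≈⟨ *-congˡ (trans (iterate-σ 1 μ) (*-congˡ (*-identityʳ μ))) ⟩
      γ * (μ * μ)               ≈⟨ *-assoc γ μ μ ⟨
      (γ * μ) * μ               ∎)

    γ≉0 : ¬ γ ≈ 0#
    γ≉0 = ∏orbit-closed (λ y → ¬ y ≈ 0#) 1≉0 x*y≉0 (λ y≉0 → x^e≉0 y≉0 (2 ^ℕ r)) s μ≉0

    τγ≈γ : τ γ ≈ γ
    τγ≈γ = ∏orbit-closed (λ y → τ y ≈ y) (^-zeroˡ q) (λ τx≈x τy≈y → trans (τ-* _ _) (*-cong τx≈x τy≈y))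
             (λ {y} τy≈y → trans (^-^-comm y (2 ^ℕ r) q) (^-congˡ (2 ^ℕ r) τy≈y)) s τμ≈μ

    δ : Carrier
    δ = proj₁ (∃x^Q≉x 2≤q q<size)

    τδ≉δ : ¬ τ δ ≈ δ
    τδ≉δ = proj₂ (∃x^Q≉x 2≤q q<size)

    D : Carrier
    D = τ δ + δ

    D≉0 : ¬ D ≈ 0#
    D≉0 = τδ≉δ ∘′ x+y≈0⇒x≈y

    D⁻¹ : Carrier
    D⁻¹ = proj₁ (inverse D D≉0)

    τD≈D : τ D ≈ D
    τD≈D = trans (frob-+ k (τ δ) δ) (trans (+-congʳ (τ-involutive δ)) (+-comm δ (τ δ)))

    γ/D : Carrier
    γ/D = γ * D⁻¹

    τ[γ/D]≈γ/D : τ γ/D ≈ γ/D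
    τ[γ/D]≈γ/D = trans (τ-* γ D⁻¹) (*-cong τγ≈γ (τ-fixed-inverse τD≈D (proj₂ (inverse D D≉0))))

    z₀ : Carrier
    z₀ = γ/D * δ

    τz₀+z₀≈γ : τ z₀ + z₀ ≈ γ
    τz₀+z₀≈γ = begin
      τ (γ/D * δ) + γ/D * δ  ≈⟨ +-congʳ (trans (τ-* γ/D δ) (*-congʳ τ[γ/D]≈γ/D)) ⟩
      γ/D * τ δ + γ/D * δ    ≈⟨ distribˡ γ/D (τ δ) δ ⟨
      (γ * D⁻¹) * D          ≈⟨ *-assoc γ D⁻¹ D ⟩
      γ * (D⁻¹ * D)          ≈⟨ *-congˡ (inverseˡ D≉0) ⟩
      γ * 1#                 ≈⟨ *-identityʳ γ ⟩
      γ                      ∎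

    Z : Carrier
    Z = ∑orbit σ (s *ℕ k) z₀

    σZ+γ≈Z : σ Z + γ ≈ Z
    σZ+γ≈Z = begin
      σ Z + γ                             ≈⟨ +-congˡ τz₀+z₀≈γ ⟨
      σ Z + (τ z₀ + z₀)                   ≈⟨ +-congˡ (+-comm (τ z₀) z₀) ⟩
      σ Z + (z₀ + τ z₀)                   ≈⟨ +-assoc (σ Z) z₀ (τ z₀) ⟨
      (σ Z + z₀) + τ z₀                   ≈⟨ +-congʳ (∑orbit-shift (frob-+ r) (frob-0 r) (s *ℕ k) z₀) ⟩
      (Z + iterate σ z₀ (s *ℕ k)) + τ z₀  ≈⟨ +-congʳ (+-congˡ (iterate-σ k z₀)) ⟩
      (Z + τ z₀) + τ z₀                   ≈⟨ +-assoc Z (τ z₀) (τ z₀) ⟩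
      Z + (τ z₀ + τ z₀)                   ≈⟨ +-congˡ (x+x≈0 (τ z₀)) ⟩
      Z + 0#                              ≈⟨ +-identityʳ Z ⟩
      Z                                   ∎

    bγ≉0 : ¬ b * γ ≈ 0#
    bγ≉0 = x*y≉0 b≉0 γ≉0

    α : Carrier
    α = σ⁻¹ (proj₁ (inverse (b * γ) bγ≉0))

    bσαγ≈1 : (b * σ α) * γ ≈ 1#
    bσαγ≈1 = begin
      (b * σ α) * γ  ≈⟨ *-congʳ (*-congˡ (σ-σ⁻¹ w)) ⟩
      (b * w) * γ    ≈⟨ solve 3 (λ b w γ → (b :* w) :* γ := (b :* γ) :* w) refl b w γ ⟩
      (b * γ) * w    ≈⟨ proj₂ (inverse (b * γ) bγ≉0) ⟩
      1#             ∎
      where w = proj₁ (inverse (b * γ) bγ≉0)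

    -- σ(N α · N γ) = N(σα · σγ), and b · σα · σγ = μ has the same norm as b.
    NαNγ≈1 : N α * N γ ≈ 1#
    NαNγ≈1 = begin
      N α * N γ              ≈⟨ σ⁻¹-σ (N α * N γ) ⟨
      σ⁻¹ (σ (N α * N γ))    ≈⟨ ^-congˡ (2 ^ℕ (M′ *ℕ r)) σ[NαNγ]≈1 ⟩
      σ⁻¹ 1#                 ≈⟨ ^-zeroˡ (2 ^ℕ (M′ *ℕ r)) ⟩
      1#                     ∎
      where
      bσασγ≈μ : b * (σ α * σ γ) ≈ μ
      bσασγ≈μ = begin
        b * (σ α * σ γ)        ≈⟨ *-congˡ (*-congˡ σγ≈γμ) ⟩
        b * (σ α * (γ * μ))    ≈⟨ solve 4 (λ b a g m → b :* (a :* (g :* m)) := ((b :* a) :* g) :* m) refl b (σ α) γ μ ⟩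
        ((b * σ α) * γ) * μ    ≈⟨ *-congʳ bσαγ≈1 ⟩
        1# * μ                 ≈⟨ *-identityˡ μ ⟩
        μ                      ∎
      N[σασγ]≈1 : N (σ α * σ γ) ≈ 1#
      N[σασγ]≈1 = *-cancelʳ (x^e≉0 b≉0 (q +ℕ 1)) (begin
        N (σ α * σ γ) * N b    ≈⟨ *-comm _ (N b) ⟩
        N b * N (σ α * σ γ)    ≈⟨ N-* b _ ⟨
        N (b * (σ α * σ γ))    ≈⟨ ^-congˡ (q +ℕ 1) bσασγ≈μ ⟩
        N μ                    ≈⟨ Nμ≈Nb ⟩
        N b                    ≈⟨ *-identityˡ (N b) ⟨
        1# * N b               ∎)
      σ[NαNγ]≈1 : σ (N α * N γ) ≈ 1#
      σ[NαNγ]≈1 = begin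
        σ (N α * N γ)          ≈⟨ ^-distrib-* (N α) (N γ) (2 ^ℕ r) ⟩
        σ (N α) * σ (N γ)      ≈⟨ *-cong (^-^-comm α (q +ℕ 1) (2 ^ℕ r)) (^-^-comm γ (q +ℕ 1) (2 ^ℕ r)) ⟩
        N (σ α) * N (σ γ)      ≈⟨ N-* (σ α) (σ γ) ⟨
        N (σ α * σ γ)          ≈⟨ N[σασγ]≈1 ⟩
        1#                     ∎

    x : Carrier
    x = α * Z

    [bσx+1]γ≈Z : (b * σ x + 1#) * γ ≈ Z
    [bσx+1]γ≈Z = begin
      (b * σ (α * Z) + 1#) * γ           ≈⟨ *-congʳ (+-congʳ (*-congˡ (^-distrib-* α Z (2 ^ℕ r)))) ⟩
      (b * (σ α * σ Z) + 1#) * γ         ≈⟨ solve 4 (λ b a z g → (b :* (a :* z) :+ con 1) :* g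
                                                                 := ((b :* a) :* g) :* z :+ g) refl b (σ α) (σ Z) γ ⟩
      ((b * σ α) * γ) * σ Z + γ          ≈⟨ +-congʳ (trans (*-congʳ bσαγ≈1) (*-identityˡ (σ Z))) ⟩
      σ Z + γ                            ≈⟨ σZ+γ≈Z ⟩
      Z                                  ∎

    N[bσx+1]≈Nx : N (b * σ x + 1#) ≈ N x
    N[bσx+1]≈Nx = *-cancelʳ (x^e≉0 γ≉0 (q +ℕ 1)) (begin
      N (b * σ x + 1#) * N γ     ≈⟨ N-* _ γ ⟨
      N ((b * σ x + 1#) * γ)     ≈⟨ ^-congˡ (q +ℕ 1) [bσx+1]γ≈Z ⟩
      N Z                        ≈⟨ *-identityˡ (N Z) ⟨
      1# * N Z                   ≈⟨ *-congʳ NαNγ≈1 ⟨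
      (N α * N γ) * N Z          ≈⟨ solve 3 (λ a g z → (a :* g) :* z := (a :* z) :* g) refl (N α) (N γ) (N Z) ⟩
      (N α * N Z) * N γ          ≈⟨ *-congʳ (N-* α Z) ⟨
      N x * N γ                  ∎)

  open FiniteField F using () renaming (_^_ to _^ᶠ_)

  ^ᶠ≡^ : ∀ x e → x ^ᶠ e ≡ x ^ e
  ^ᶠ≡^ x zero    = ≡.refl
  ^ᶠ≡^ x (suc e) = cong (x *_) (^ᶠ≡^ x e)

  solution : ∀ b → ¬ b ≈ 0# → ∃ λ x → (b * x ^ᶠ (2 ^ℕ r) + 1#) ^ᶠ (q +ℕ 1) + x ^ᶠ (q +ℕ 1) ≈ 0#
  solution b b≉0 = x , (begin
    (b * x ^ᶠ (2 ^ℕ r) + 1#) ^ᶠ (q +ℕ 1) + x ^ᶠ (q +ℕ 1)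
      ≡⟨ ≡.cong₂ _+_ (≡.trans (^ᶠ≡^ _ (q +ℕ 1)) (cong (λ y → N (b * y + 1#)) (^ᶠ≡^ x (2 ^ℕ r))))
                     (^ᶠ≡^ x (q +ℕ 1)) ⟩
    N (b * σ x + 1#) + N x
      ≈⟨ x≈y⇒x+y≈0 N[bσx+1]≈Nx ⟩
    0# ∎)
    where open Solution b≉0

-- In the case 1 + x r = y M the inverse of r is −x ≡ x (M − 1) modulo M.
invertible-mod : ∀ {r M} → 2 ≤ M → gcd r M ≡ 1 → ∃₂ λ s t → r *ℕ s ≡ suc (t *ℕ M)
invertible-mod {r} {M@(suc (suc M″))} (s≤s (s≤s _)) gcd≡1 with coprime-Bézout (gcd≡1⇒coprime gcd≡1)
... | Bézout.+- x y 1+yM≡xr = x , y , ≡.trans (ℕ.*-comm r x) (≡.sym 1+yM≡xr)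
... | Bézout.-+ x (suc y) 1+xr≡yM = x *ℕ suc M″ , y *ℕ suc M″ +ℕ M″ , (begin
  r *ℕ (x *ℕ suc M″)              ≡⟨ ℕ.*-assoc r x (suc M″) ⟨
  (r *ℕ x) *ℕ suc M″              ≡⟨ cong (_*ℕ suc M″) (≡.trans (ℕ.*-comm r x) (ℕ.suc-injective 1+xr≡yM)) ⟩
  (suc M″ +ℕ y *ℕ M) *ℕ suc M″    ≡⟨ rearrange y M″ ⟩
  suc ((y *ℕ suc M″ +ℕ M″) *ℕ M)  ∎)
  where
  open ≡.≡-Reasoning
  rearrange : ∀ y M″ → (suc M″ +ℕ y *ℕ suc (suc M″)) *ℕ suc M″ ≡ suc ((y *ℕ suc M″ +ℕ M″) *ℕ suc (suc M″))
  rearrange = solve-∀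

m≡m/2+m/2 : ∀ {m} → 2 ∣ m → m ≡ m / 2 +ℕ m / 2
m≡m/2+m/2 {m} 2∣m = ≡.trans (≡.sym (m/n*n≡m 2∣m)) (double (m / 2))
  where
  double : ∀ h → h *ℕ 2 ≡ h +ℕ h
  double = solve-∀

norm-equation : ∀ {c ℓ} k′ r → gcd r (suc k′ +ℕ suc k′) ≡ 1 →
  (F : FiniteField c ℓ (2 ^ℕ suc k′ *ℕ 2 ^ℕ suc k′)) →
  let open FiniteField F
      q = 2 ^ℕ suc k′
  in ∀ b → ¬ b ≈ 0# → ∃ λ x → ((b * (x ^ (2 ^ℕ r)) + 1#) ^ (q +ℕ 1)) + (x ^ (q +ℕ 1)) ≈ 0#
norm-equation k′ r gcd≡1
  with 2 ^ℕ suc k′ *ℕ 2 ^ℕ suc k′ in size≡ | invertible-mod {r} (ℕ.+-mono-≤ (s≤s z≤n) (s≤s z≤n)) gcd≡1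
... | zero  | _           = λ F → ⊥-elim (¬Fin0 (Bijection.to (FiniteField.card F) (FiniteField.0# F)))
... | suc n | s , t , rs≡ = λ F → NormEquation.solution F k′ (≡.sym size≡) r s t rs≡

lemma3p2 : ∀ {c ℓ} (m r : ℕ) → 0 < m → 2 ∣ m → 0 < r → gcd r m ≡ 1 →
           (F : FiniteField c ℓ ((2 ^ℕ (m / 2)) *ℕ (2 ^ℕ (m / 2)))) →
           let open FiniteField F
               q = 2 ^ℕ (m / 2)
           in ∀ (b : Carrier) → ¬ (b ≈ 0#) →
              ∃ λ (x : Carrier) →
                ((b * (x ^ (2 ^ℕ r)) + 1#) ^ (q +ℕ 1)) + (x ^ (q +ℕ 1)) ≈ 0#
lemma3p2 m r 0<m 2∣m _ gcd≡1 with m / 2 | m≡m/2+m/2 2∣m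
... | zero   | m≡0   = ⊥-elim (ℕ.<⇒≢ 0<m (≡.sym m≡0))
... | suc k′ | m≡k+k = norm-equation k′ r (≡.subst (λ M → gcd r M ≡ 1) m≡k+k gcd≡1)
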